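{- Let $n$ be an even positive integer and let $G$ be a graph without a connected matching of size $n/2$. For each connected component $C$ of $G$, fix any partition $V(C)=S_C\cup Q_C\cup I_C$ satisfying: (1) $|Q_C|+2|S_C|=\min\{v(C),n-1\}$; (2) $I_C$ is independent, and $I_C=\emptyset$ if $v(C)\leq n-1$; (3) every vertex of $Q_C$ has at most one neighbor in $I_C$; (4) every vertex of $I_C$ has degree less than $n/2$. For a vertex $v$ lying in component $C$ define \[f(v)=\begin{cases}\frac{n-1}{4}, & v\in S_C,\\ \frac{n-1}{2}-\frac{\deg(v)}{2}, & v\in Q_C,\\ 0, & v\in I_C,\end{cases}\] and set $f(G)=\frac{n-1}{2}v(G)-e(G)$. Then \[\sum_{v\in V(G)} f(v)\leq f(G).\]
   Context: Graphs are finite and simple; $v(\cdot)$, $e(\cdot)$ denote numbers of vertices and edges, and $\deg(v)$ is the degree of $v$ in $G$. A matching is connected in $G$ if all its edges lie in one connected component of $G$; its size is its number of edges. (Each component, being connected and without a matching of size $n/2$, admits such a partition.) -}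

module Defs where

open import Data.Nat as ℕ using (ℕ; zero; suc; _+_; _*_; _∸_; _≤_; _<_; ⌊_/2⌋; _⊓_)
open import Data.Bool using (Bool; true; false; if_then_else_; _∧_; _∨_; not)
open import Data.Fin using (Fin; toℕ; zero; suc)
open import Data.Fin.Properties using () renaming (_≟_ to _≟F_)
open import Data.Product using (Σ; _×_; _,_; ∃; proj₁; proj₂)
open import Data.Vec using (Vec; lookup)
open import Data.Integer using (+_)
open import Data.Rational as ℚ using (ℚ; 0ℚ; _/_)
open import Relation.Binary.PropositionalEquality using (_≡_; _≢_)
open import Relation.Nullary using (¬_)
open import Relation.Nullary.Decidable using (⌊_⌋)

record Graph (N : ℕ) : Set where
  field
    adj   : Fin N → Fin N → Bool
    sym   : ∀ u v → adj u v ≡ adj v u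
    irrefl : ∀ v → adj v v ≡ false
open Graph public

count : {N : ℕ} → (Fin N → Bool) → ℕ
count {zero}  p = 0
count {suc N} p = (if p zero then 1 else 0) + count (λ x → p (suc x))

anyF : {N : ℕ} → (Fin N → Bool) → Bool
anyF {zero}  p = false
anyF {suc N} p = p zero ∨ anyF (λ x → p (suc x))

sumℕ : {N : ℕ} → (Fin N → ℕ) → ℕ
sumℕ {zero}  f = 0
sumℕ {suc N} f = f zero + sumℕ (λ x → f (suc x))

sumℚ : {N : ℕ} → (Fin N → ℚ) → ℚ
sumℚ {zero}  f = 0ℚ
sumℚ {suc N} f = f zero ℚ.+ sumℚ (λ x → f (suc x))

module _ {N : ℕ} (G : Graph N) where

  deg : Fin N → ℕ
  deg v = count (adj G v)

  edges : ℕ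
  edges = sumℕ (λ u → count (λ v → (toℕ u ℕ.<ᵇ toℕ v) ∧ adj G u v))

  reachIn : ℕ → Fin N → Fin N → Bool
  reachIn zero    u v = ⌊ u ≟F v ⌋
  reachIn (suc k) u v = reachIn k u v ∨ anyF (λ w → reachIn k u w ∧ adj G w v)

  -- u and v lie in the same connected component (a path has length < N)
  reach : Fin N → Fin N → Bool
  reach = reachIn N

  record ConnectedMatching (k : ℕ) : Set where
    field
      edge     : Vec (Fin N × Fin N) k
      isEdge   : ∀ i → adj G (proj₁ (lookup edge i)) (proj₂ (lookup edge i)) ≡ true
      disjoint : ∀ i j → i ≢ j →
                   proj₁ (lookup edge i) ≢ proj₁ (lookup edge j) ×
                   proj₁ (lookup edge i) ≢ proj₂ (lookup edge j) ×
                   proj₂ (lookup edge i) ≢ proj₁ (lookup edge j) ×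
                   proj₂ (lookup edge i) ≢ proj₂ (lookup edge j)
      root     : Fin N
      connected : ∀ i → reach root (proj₁ (lookup edge i)) ≡ true

data Part : Set where
  S Q I : Part

isS isQ isI : Part → Bool
isS S = true
isS _ = false
isQ Q = true
isQ _ = false
isI I = true
isI _ = false

module _ {N : ℕ} (n : ℕ) (G : Graph N) (L : Fin N → Part) where

  compSize : Fin N → ℕ
  compSize v = count (reach G v)

  sizeS sizeQ : Fin N → ℕ
  sizeS v = count (λ u → reach G v u ∧ isS (L u))
  sizeQ v = count (λ u → reach G v u ∧ isQ (L u))

  -- conditions (1)–(4), imposed on every component (the component of each vertex v)
  record ValidPartition : Set where
    field
      cond1 : ∀ v → sizeQ v + 2 * sizeS v ≡ compSize v ⊓ (n ∸ 1)
      cond2-indep : ∀ u w → L u ≡ I → L w ≡ I → adj G u w ≡ false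
      cond2-small : ∀ v → compSize v ≤ n ∸ 1 → L v ≢ I
      cond3 : ∀ v → L v ≡ Q → count (λ w → adj G v w ∧ isI (L w)) ≤ 1
      cond4 : ∀ v → L v ≡ I → deg G v < ⌊ n /2⌋

  fv : Fin N → ℚ
  fv v with L v
  ... | S = + (n ∸ 1) / 4
  ... | Q = (+ (n ∸ 1) / 2) ℚ.- (+ deg G v / 2)
  ... | I = 0ℚ

fG : {N : ℕ} → ℕ → Graph N → ℚ
fG {N} n G = ((+ (n ∸ 1) / 2) ℚ.* (+ N / 1)) ℚ.- (+ edges G / 1)

module Submission where

-- Put n' = n − 1 and give each vertex the natural-number weight
-- w(v) = 4 f(v) + 2 deg(v), i.e. n' + 2 deg(v) on S, 2n' on Q and 2 deg(v) on I.  By the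
-- handshake lemma Σ deg = 2 e(G), so the theorem is equivalent to Σ_v w(v) ≤ 2n'·v(G).  That
-- inequality is proved component by component: in a component C with |C| = c we have
-- deg ≤ c on S and 2 deg ≤ n' on I (condition (4)), so Σ_C w ≤ (n' + 2c)|S| + 2n'|Q| + n'|I|,
-- and condition (1) turns this into at most 2n'·c by a little arithmetic.

open import Defs renaming (sym to adj-sym)
open import Data.Nat using (ℕ; zero; suc; _+_; _*_; _∸_; _≤_; _<_; ⌊_/2⌋; ⌈_/2⌉; _⊓_; _<ᵇ_; z≤n; s≤s; s≤s⁻¹)
open import Data.Nat.Properties
open import Data.Nat.Tactic.RingSolver using (solve-∀)
open import Data.Bool using (Bool; true; false; if_then_else_; _∧_; _∨_; not; T)
open import Data.Unit using (tt)
open import Data.Fin using (Fin; zero; suc; toℕ)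
open import Data.Fin.Properties using (toℕ-injective) renaming (_≟_ to _≟F_)
open import Data.Product using (Σ; _×_; _,_; proj₁)
open import Data.Sum using (_⊎_; inj₁; inj₂)
open import Data.Empty using (⊥-elim)
open import Relation.Binary.PropositionalEquality
open import Relation.Nullary using (¬_; yes; no)
open import Data.Nat.Divisibility using (_∣_)
import Data.Integer as ℤ
import Data.Integer.Properties as ℤ
open import Data.Rational as ℚ using (ℚ; _/_; 0ℚ; ½; toℚᵘ)
import Data.Rational.Properties as ℚ
open import Data.Rational.Unnormalised as ℚᵘ using (mkℚᵘ; *≡*; *≤*)
import Data.Rational.Unnormalised.Properties as ℚᵘ
open import Data.Rational.Solver using (module +-*-Solver)
open import Algebra.Properties.Semiring.Sum +-*-semiring
  using (sum; sum-cong-≗; ∑-distrib-+; ∑-comm; *-distribˡ-sum)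

_⊆_ : {N : ℕ} → (Fin N → Bool) → (Fin N → Bool) → Set
A ⊆ B = ∀ x → A x ≡ true → B x ≡ true

clash : ∀ {ℓ} {C : Set ℓ} {b : Bool} → b ≡ true → b ≡ false → C
clash refl ()

∧-true : ∀ {a b} → a ∧ b ≡ true → a ≡ true × b ≡ true
∧-true {true} {true} _ = refl , refl

𝟙 : Bool → ℕ
𝟙 b = if b then 1 else 0

⊆-or-witness : ∀ {N} (A B : Fin N → Bool) → A ⊆ B ⊎ Σ (Fin N) λ x → A x ≡ true × B x ≡ false
⊆-or-witness {zero} A B = inj₁ λ ()
⊆-or-witness {suc N} A B with A zero in a0 | B zero in b0
  | ⊆-or-witness (λ x → A (suc x)) (λ x → B (suc x))
... | true  | false | _ = inj₂ (zero , a0 , b0)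
... | _ | _ | inj₂ (x , px , qx) = inj₂ (suc x , px , qx)
... | false | _ | inj₁ tail⊆ = inj₁ λ { zero e → clash e a0 ; (suc x) e → tail⊆ x e }
... | true | true | inj₁ tail⊆ = inj₁ λ { zero _ → b0 ; (suc x) e → tail⊆ x e }

⊆-antisym : ∀ {N} {A B : Fin N → Bool} → A ⊆ B → B ⊆ A → ∀ x → A x ≡ B x
⊆-antisym {A = A} {B} A⊆B B⊆A x with A x in ax | B x in bx
... | false | false = refl
... | true  | true  = refl
... | true  | false = clash (A⊆B x ax) bx
... | false | true  = clash (B⊆A x bx) ax

sumℕ≡sum : ∀ {N} (f : Fin N → ℕ) → sumℕ f ≡ sum f
sumℕ≡sum {zero}  f = refl
sumℕ≡sum {suc N} f = cong (f zero +_) (sumℕ≡sum (λ x → f (suc x)))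

count≡sum : ∀ {N} (A : Fin N → Bool) → count A ≡ sum (λ x → 𝟙 (A x))
count≡sum {zero}  A = refl
count≡sum {suc N} A = cong (𝟙 (A zero) +_) (count≡sum (λ x → A (suc x)))

sum-const : ∀ N c → sum {N} (λ _ → c) ≡ N * c
sum-const zero    c = refl
sum-const (suc N) c = cong (c +_) (sum-const N c)

sum-mono : ∀ {N} {f g : Fin N → ℕ} → (∀ x → f x ≤ g x) → sum f ≤ sum g
sum-mono {zero}  f≤g = z≤n
sum-mono {suc N} f≤g = +-mono-≤ (f≤g zero) (sum-mono (λ x → f≤g (suc x)))

sum-mono-< : ∀ {N} {f g : Fin N → ℕ} → (∀ x → f x ≤ g x) → ∀ y → f y < g y → sum f < sum g
sum-mono-< f≤g zero    fy<gy = +-mono-<-≤ fy<gy (sum-mono (λ x → f≤g (suc x)))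
sum-mono-< f≤g (suc y) fy<gy = +-mono-≤-< (f≤g zero) (sum-mono-< (λ x → f≤g (suc x)) y fy<gy)

𝟙-mono : ∀ {a b} → (a ≡ true → b ≡ true) → 𝟙 a ≤ 𝟙 b
𝟙-mono {false} a⇒b = z≤n
𝟙-mono {true}  a⇒b rewrite a⇒b refl = ≤-refl

count-mono : ∀ {N} {A B : Fin N → Bool} → A ⊆ B → count A ≤ count B
count-mono {A = A} {B} A⊆B = subst₂ _≤_ (sym (count≡sum A)) (sym (count≡sum B))
  (sum-mono (λ x → 𝟙-mono (A⊆B x)))

count-mono-< : ∀ {N} {A B : Fin N → Bool} → A ⊆ B → ∀ x → A x ≡ false → B x ≡ true → count A < count B
count-mono-< {A = A} {B} A⊆B x ax bx = subst₂ _<_ (sym (count≡sum A)) (sym (count≡sum B))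
  (sum-mono-< (λ y → 𝟙-mono (A⊆B y)) x (subst₂ (λ a b → 𝟙 a < 𝟙 b) (sym ax) (sym bx) ≤-refl))

count-≤-size : ∀ {N} (A : Fin N → Bool) → count A ≤ N
count-≤-size {N} A = ≤-trans (count-mono {A = A} {B = λ _ → true} (λ _ _ → refl))
  (≤-reflexive (trans (count≡sum {N} (λ _ → true)) (trans (sum-const N 1) (*-identityʳ N))))

anyF-intro : ∀ {N} (A : Fin N → Bool) x → A x ≡ true → anyF A ≡ true
anyF-intro A zero    ax rewrite ax = refl
anyF-intro A (suc x) ax with A zero
... | true  = refl
... | false = anyF-intro (λ y → A (suc y)) x ax

anyF-elim : ∀ {N} (A : Fin N → Bool) → anyF A ≡ true → Σ (Fin N) λ x → A x ≡ true
anyF-elim {suc N} A any with A zero in a0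
... | true  = zero , a0
... | false with anyF-elim (λ y → A (suc y)) any
...   | x , ax = suc x , ax

anyF-cong : ∀ {N} {A B : Fin N → Bool} → (∀ x → A x ≡ B x) → anyF A ≡ anyF B
anyF-cong {zero}  A≗B = refl
anyF-cong {suc N} A≗B = cong₂ _∨_ (A≗B zero) (anyF-cong (λ x → A≗B (suc x)))

-- Each step either adds a
-- point or is stationary forever, so everything reached at all is reached by stage N.
module Saturation {N : ℕ} (P : ℕ → Fin N → Bool)
  (next : (Fin N → Bool) → Fin N → Bool)
  (next-cong : ∀ {A B} → (∀ x → A x ≡ B x) → ∀ x → next A x ≡ next B x)
  (P-suc : ∀ k x → P (suc k) x ≡ next (P k) x)
  (inflationary : ∀ k → P k ⊆ P (suc k)) where

  Stationary : ℕ → Set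
  Stationary j = ∀ x → P (suc j) x ≡ P j x

  inflate : ∀ j k → P k ⊆ P (j + k)
  inflate zero    k x pk = pk
  inflate (suc j) k x pk = inflationary (j + k) x (inflate j k x pk)

  stays-stationary : ∀ j → Stationary j → ∀ t x → P (t + j) x ≡ P j x
  stays-stationary j st zero    x = refl
  stays-stationary j st (suc t) x = begin
    P (suc (t + j)) x  ≡⟨ P-suc (t + j) x ⟩
    next (P (t + j)) x ≡⟨ next-cong (stays-stationary j st t) x ⟩
    next (P j) x       ≡⟨ sym (P-suc j x) ⟩
    P (suc j) x        ≡⟨ st x ⟩
    P j x              ∎
    where open ≡-Reasoning

  grow : ∀ k → (Σ ℕ λ j → j < k × Stationary j) ⊎ k ≤ count (P k)
  grow zero = inj₂ z≤n
  grow (suc k) with grow k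
  ... | inj₁ (j , j<k , st) = inj₁ (j , m<n⇒m<1+n j<k , st)
  ... | inj₂ k≤size with ⊆-or-witness (P (suc k)) (P k)
  ...   | inj₁ shrink = inj₁ (k , ≤-refl , ⊆-antisym shrink (inflationary k))
  ...   | inj₂ (x , new , old) =
          inj₂ (≤-trans (s≤s k≤size) (count-mono-< (inflationary k) x old new))

  -- a set of at most N points cannot grow N + 1 times
  stationary-by-N : Σ ℕ λ j → j ≤ N × Stationary j
  stationary-by-N with grow (suc N)
  ... | inj₁ (j , j<1+N , st) = j , s≤s⁻¹ j<1+N , st
  ... | inj₂ 1+N≤size = ⊥-elim (<⇒≱ 1+N≤size (count-≤-size (P (suc N))))

  stable-after-N : ∀ m x → P (m + N) x ≡ P N x
  stable-after-N m x with stationary-by-N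
  ... | j , j≤N , st = begin
    P (m + N) x              ≡⟨ cong (λ i → P i x) (split-at-j m) ⟩
    P ((m + (N ∸ j)) + j) x  ≡⟨ stays-stationary j st (m + (N ∸ j)) x ⟩
    P j x                    ≡⟨ sym (stays-stationary j st (N ∸ j) x) ⟩
    P ((N ∸ j) + j) x        ≡⟨ cong (λ i → P i x) (m∸n+n≡m j≤N) ⟩
    P N x                    ∎
    where
    open ≡-Reasoning
    split-at-j : ∀ m → m + N ≡ (m + (N ∸ j)) + j
    split-at-j m = trans (cong (m +_) (sym (m∸n+n≡m j≤N))) (sym (+-assoc m (N ∸ j) j))

  saturate : ∀ k → P k ⊆ P N
  saturate k x pk = trans (sym (stable-after-N k x))
    (subst (λ i → P i x ≡ true) (+-comm N k) (inflate N k x pk))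

module Connectivity {N : ℕ} (G : Graph N) where

  walk-refl : ∀ u → reachIn G 0 u u ≡ true
  walk-refl u with u ≟F u
  ... | yes _  = refl
  ... | no u≢u = ⊥-elim (u≢u refl)

  walk-zero : ∀ {u x} → reachIn G 0 u x ≡ true → u ≡ x
  walk-zero {u} {x} w with u ≟F x
  ... | yes u≡x = u≡x

  walk-longer : ∀ k {u x} → reachIn G k u x ≡ true → reachIn G (suc k) u x ≡ true
  walk-longer k w rewrite w = refl

  walk-step : ∀ k {u y x} → reachIn G k u y ≡ true → adj G y x ≡ true → reachIn G (suc k) u x ≡ true
  walk-step k {u} {y} {x} w a with reachIn G k u x
  ... | true  = refl
  ... | false = anyF-intro (λ z → reachIn G k u z ∧ adj G z x) y (subst₂ (λ b c → b ∧ c ≡ true) (sym w) (sym a) refl)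

  walk-last : ∀ k {u x} → reachIn G (suc k) u x ≡ true →
              reachIn G k u x ≡ true ⊎ Σ (Fin N) λ y → reachIn G k u y ≡ true × adj G y x ≡ true
  walk-last k {u} {x} w with reachIn G k u x
  ... | true  = inj₁ refl
  ... | false with anyF-elim (λ z → reachIn G k u z ∧ adj G z x) w
  ...   | y , wy = inj₂ (y , ∧-true wy)

  walk-concat : ∀ a b {u w x} → reachIn G a u w ≡ true → reachIn G b w x ≡ true → reachIn G (b + a) u x ≡ true
  walk-concat a zero    w₁ w₂ = subst (λ z → reachIn G a _ z ≡ true) (walk-zero w₂) w₁
  walk-concat a (suc b) w₁ w₂ with walk-last b w₂
  ... | inj₁ w  = walk-longer (b + a) (walk-concat a b w₁ w)
  ... | inj₂ (y , w , e) = walk-step (b + a) (walk-concat a b w₁ w) e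

  walk-reverse : ∀ k {u x} → reachIn G k u x ≡ true → reachIn G k x u ≡ true
  walk-reverse zero    w = subst (λ z → reachIn G 0 z _ ≡ true) (walk-zero w) (walk-refl _)
  walk-reverse (suc k) {u} {x} w with walk-last k w
  ... | inj₁ w′ = walk-longer k (walk-reverse k w′)
  ... | inj₂ (y , w′ , e) = subst (λ i → reachIn G i x u ≡ true) (+-comm k 1)
        (walk-concat 1 k (walk-step 0 (walk-refl x) (trans (adj-sym G x y) e)) (walk-reverse k w′))

  reach-walk : ∀ k {u x} → reachIn G k u x ≡ true → reach G u x ≡ true
  reach-walk k {u} {x} = saturate k x
    where
    open Saturation (λ i → reachIn G i u) (λ A x → A x ∨ anyF (λ z → A z ∧ adj G z x))
      (λ A≗B x → cong₂ _∨_ (A≗B x) (anyF-cong (λ z → cong (_∧ adj G z x) (A≗B z))))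
      (λ _ _ → refl) (λ i x → walk-longer i)

  reach-refl : ∀ u → reach G u u ≡ true
  reach-refl u = reach-walk 0 (walk-refl u)

  reach-adj : ∀ {u x} → adj G u x ≡ true → reach G u x ≡ true
  reach-adj a = reach-walk 1 (walk-step 0 (walk-refl _) a)

  reach-sym : ∀ {u x} → reach G u x ≡ true → reach G x u ≡ true
  reach-sym = walk-reverse N

  reach-trans : ∀ {u w x} → reach G u w ≡ true → reach G w x ≡ true → reach G u x ≡ true
  reach-trans r₁ r₂ = reach-walk (N + N) (walk-concat N N r₁ r₂)

-- Handshake lemma: the degree sum counts every edge twice.  An adjacent pair u, v is
-- counted in `edges` exactly once, from whichever endpoint has the smaller index.
module Handshake {N : ℕ} (G : Graph N) where

  forward : Fin N → Fin N → ℕ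
  forward u v = 𝟙 ((toℕ u <ᵇ toℕ v) ∧ adj G u v)

  adj-splits : ∀ u v → 𝟙 (adj G u v) ≡ forward u v + forward v u
  adj-splits u v with toℕ u <ᵇ toℕ v in u<v | toℕ v <ᵇ toℕ u in v<u
  ... | true  | true  = ⊥-elim (<-asym (<ᵇ-true {toℕ u} {toℕ v} u<v) (<ᵇ-true {toℕ v} {toℕ u} v<u))
    where
    <ᵇ-true : ∀ {m n} → (m <ᵇ n) ≡ true → m < n
    <ᵇ-true {m} {n} e = <ᵇ⇒< m n (subst T (sym e) tt)
  ... | true  | false = sym (+-identityʳ _)
  ... | false | true  = cong 𝟙 (adj-sym G u v)
  ... | false | false = subst (λ x → 𝟙 (adj G u x) ≡ 0) u≡v (cong 𝟙 (irrefl G u))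
    where
    ≮ : ∀ {m n} → (m <ᵇ n) ≡ false → n ≤ m
    ≮ {m} {n} e = ≮⇒≥ (λ m<n → subst T e (<⇒<ᵇ m<n))
    u≡v : u ≡ v
    u≡v = toℕ-injective (≤-antisym (≮ {toℕ v} {toℕ u} v<u) (≮ {toℕ u} {toℕ v} u<v))

  handshake : sumℕ (deg G) ≡ 2 * edges G
  handshake = begin
    sumℕ (deg G)                                          ≡⟨ sumℕ≡sum (deg G) ⟩
    sum (λ u → count (adj G u))                           ≡⟨ sum-cong-≗ (λ u → count≡sum (adj G u)) ⟩
    sum (λ u → sum (λ v → 𝟙 (adj G u v)))                 ≡⟨ sum-cong-≗ (λ u → sum-cong-≗ (adj-splits u)) ⟩
    sum (λ u → sum (λ v → forward u v + forward v u))     ≡⟨ sum-cong-≗ (λ u → ∑-distrib-+ (forward u) (λ v → forward v u)) ⟩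
    sum (λ u → sum (forward u) + sum (λ v → forward v u)) ≡⟨ ∑-distrib-+ (λ u → sum (forward u)) (λ u → sum (λ v → forward v u)) ⟩
    E + sum (λ u → sum (λ v → forward v u))               ≡⟨ cong (E +_) (∑-comm (λ u v → forward v u)) ⟩
    E + E                                                 ≡⟨ cong (λ m → m + m) E≡edges ⟩
    edges G + edges G                                     ≡⟨ cong (edges G +_) (+-identityʳ (edges G)) ⟨
    2 * edges G                                           ∎
    where
    open ≡-Reasoning
    E : ℕ
    E = sum (λ u → sum (forward u))
    E≡edges : E ≡ edges G
    E≡edges = sym (trans (sumℕ≡sum (λ u → count (λ v → (toℕ u <ᵇ toℕ v) ∧ adj G u v)))
                         (sum-cong-≗ (λ u → count≡sum (λ v → (toℕ u <ᵇ toℕ v) ∧ adj G u v))))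

sumOver : ∀ {N} → (Fin N → Bool) → (Fin N → ℕ) → ℕ
sumOver A f = sum (λ u → if A u then f u else 0)

sumOver-empty : ∀ {N} {A : Fin N → Bool} → (∀ x → A x ≡ false) → ∀ f → sumOver A f ≡ 0
sumOver-empty {N} {A} empty f = trans (sum-cong-≗ vanish) (trans (sum-const N 0) (*-zeroʳ N))
  where
  vanish : ∀ u → (if A u then f u else 0) ≡ 0
  vanish u rewrite empty u = refl

sumOver-const : ∀ {N} (A : Fin N → Bool) x → sumOver A (λ _ → x) ≡ x * count A
sumOver-const A x = begin
  sum (λ u → if A u then x else 0)  ≡⟨ sum-cong-≗ (λ u → times-𝟙 (A u)) ⟨
  sum (λ u → x * 𝟙 (A u))           ≡⟨ *-distribˡ-sum x (λ u → 𝟙 (A u)) ⟨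
  x * sum (λ u → 𝟙 (A u))           ≡⟨ cong (x *_) (count≡sum A) ⟨
  x * count A                       ∎
  where
  open ≡-Reasoning
  times-𝟙 : ∀ b → x * 𝟙 b ≡ (if b then x else 0)
  times-𝟙 true  = *-identityʳ x
  times-𝟙 false = *-zeroʳ x

-- If r is an equivalence relation on Fin N and on every class the
-- sum of a is at most that of b, then so are the total sums: induct on the size of an
-- r-closed set, splitting off one class at a time.
module ClassSums {N : ℕ} (r : Fin N → Fin N → Bool)
  (r-refl : ∀ u → r u u ≡ true)
  (r-sym : ∀ {u w} → r u w ≡ true → r w u ≡ true)
  (r-trans : ∀ {u w x} → r u w ≡ true → r w x ≡ true → r u x ≡ true)
  (a b : Fin N → ℕ)
  (per-class : ∀ v → sumOver (r v) a ≤ sumOver (r v) b) where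

  Closed : (Fin N → Bool) → Set
  Closed A = ∀ {w u} → A w ≡ true → r w u ≡ true → A u ≡ true

  _∖class_ : (Fin N → Bool) → Fin N → Fin N → Bool
  (A ∖class v) u = A u ∧ not (r v u)

  module _ {A : Fin N → Bool} (closed : Closed A) {v : Fin N} (av : A v ≡ true) where

    split-class : ∀ f → sumOver A f ≡ sumOver (A ∖class v) f + sumOver (r v) f
    split-class f = trans (sum-cong-≗ pointwise)
      (∑-distrib-+ (λ u → if (A ∖class v) u then f u else 0) (λ u → if r v u then f u else 0))
      where
      pointwise : ∀ u → (if A u then f u else 0)
                      ≡ (if (A ∖class v) u then f u else 0) + (if r v u then f u else 0)
      pointwise u with r v u in rvu
      ... | true rewrite closed av rvu = refl
      ... | false with A u
      ...   | true  = sym (+-identityʳ (f u))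
      ...   | false = refl

    ∖class-closed : Closed (A ∖class v)
    ∖class-closed {w} {u} aw rwu with ∧-true aw | r v u in rvu
    ... | _ , not-rvw | true  = clash (r-trans rvu (r-sym rwu)) (not-true not-rvw)
      where
      not-true : ∀ {c} → not c ≡ true → c ≡ false
      not-true {false} _ = refl
    ... | au , _      | false rewrite closed au rwu = refl

    ∖class-smaller : count (A ∖class v) < count A
    ∖class-smaller = count-mono-< (λ u e → proj₁ (∧-true e)) v removed av
      where
      removed : (A ∖class v) v ≡ false
      removed rewrite av | r-refl v = refl

  closed-sums : ∀ k A → count A ≤ k → Closed A → sumOver A a ≤ sumOver A b
  closed-sums k A size closed with ⊆-or-witness A (λ _ → false)
  closed-sums k A size closed | inj₁ A⊆∅ =
    ≤-reflexive (trans (sumOver-empty empty a) (sym (sumOver-empty empty b)))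
    where
    empty : ∀ x → A x ≡ false
    empty = ⊆-antisym A⊆∅ (λ _ ())
  closed-sums zero A size closed | inj₂ (v , av , _) =
    ⊥-elim (<⇒≱ (∖class-smaller closed av) (≤-trans size z≤n))
  closed-sums (suc k) A size closed | inj₂ (v , av , _) = begin
    sumOver A a                                  ≡⟨ split-class closed av a ⟩
    sumOver (A ∖class v) a + sumOver (r v) a     ≤⟨ +-mono-≤ rest (per-class v) ⟩
    sumOver (A ∖class v) b + sumOver (r v) b     ≡⟨ split-class closed av b ⟨
    sumOver A b                                  ∎
    where
    open ≤-Reasoning
    rest : sumOver (A ∖class v) a ≤ sumOver (A ∖class v) b
    rest = closed-sums k (A ∖class v) (s≤s⁻¹ (≤-trans (∖class-smaller closed av) size))
             (∖class-closed closed av)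

  sum-by-classes : sum a ≤ sum b
  sum-by-classes = closed-sums N (λ _ → true) (count-≤-size _) (λ _ _ → refl)

module PartSums {N : ℕ} (L : Fin N → Part) (R : Fin N → Bool) where

  #S #Q #I : ℕ
  #S = count (λ u → R u ∧ isS (L u))
  #Q = count (λ u → R u ∧ isQ (L u))
  #I = count (λ u → R u ∧ isI (L u))

  sumOver-by-part : ∀ (g : Part → ℕ) → sumOver R (λ u → g (L u)) ≡ g S * #S + g Q * #Q + g I * #I
  sumOver-by-part g = begin
    sumOver R (λ u → g (L u))                                 ≡⟨ sum-cong-≗ pointwise ⟩
    sum (λ u → part S u + part Q u + part I u)                ≡⟨ ∑-distrib-+ (λ u → part S u + part Q u) (part I) ⟩
    sum (λ u → part S u + part Q u) + sum (part I)            ≡⟨ cong (_+ sum (part I)) (∑-distrib-+ (part S) (part Q)) ⟩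
    sum (part S) + sum (part Q) + sum (part I)                ≡⟨ cong₂ _+_ (cong₂ _+_ (size S) (size Q)) (size I) ⟩
    g S * #S + g Q * #Q + g I * #I                            ∎
    where
    open ≡-Reasoning
    isPart : Part → Part → Bool
    isPart S = isS
    isPart Q = isQ
    isPart I = isI
    part : Part → Fin N → ℕ
    part p u = if R u ∧ isPart p (L u) then g p else 0
    size : ∀ p → sum (part p) ≡ g p * count (λ u → R u ∧ isPart p (L u))
    size p = sumOver-const (λ u → R u ∧ isPart p (L u)) (g p)
    pointwise : ∀ u → (if R u then g (L u) else 0) ≡ part S u + part Q u + part I u
    pointwise u with R u | L u
    ... | false | _ = refl
    ... | true  | S = sym (trans (+-identityʳ _) (+-identityʳ _))
    ... | true  | Q = sym (+-identityʳ _)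
    ... | true  | I = refl

  count-by-part : count R ≡ #S + #Q + #I
  count-by-part = begin
    count R                          ≡⟨ count≡sum R ⟩
    sumOver R (λ _ → 1)              ≡⟨ sumOver-by-part (λ _ → 1) ⟩
    1 * #S + 1 * #Q + 1 * #I         ≡⟨ cong₂ _+_ (cong₂ _+_ (*-identityˡ #S) (*-identityˡ #Q)) (*-identityˡ #I) ⟩
    #S + #Q + #I                     ∎
    where open ≡-Reasoning

-- the two ways the component data enter condition (1)
k+q+k≡q+2k : ∀ k q → k + q + k ≡ q + 2 * k
k+q+k≡q+2k = solve-∀

-- The arithmetic heart of the bound for one component: c = k + q + m vertices, k of them
-- in S, q in Q, m in I, satisfying condition (1) q + 2k = min(c, n').
-- If c ≤ n' then (1) forces k = m and the bound follows from c ≤ n'.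
small-component : ∀ n' k q m → k + q + m ≤ n' → q + 2 * k ≡ k + q + m →
                  (n' + 2 * (k + q + m)) * k + 2 * n' * q + n' * m ≤ 2 * n' * (k + q + m)
small-component n' k q m c≤n' cond with +-cancelˡ-≡ (k + q) k m (trans (k+q+k≡q+2k k q) cond)
... | refl = begin
  (n' + 2 * (k + q + k)) * k + 2 * n' * q + n' * k  ≤⟨ +-monoˡ-≤ (n' * k) (+-monoˡ-≤ (2 * n' * q)
                                                        (*-monoˡ-≤ k (+-monoʳ-≤ n' (*-monoʳ-≤ 2 c≤n')))) ⟩
  (n' + 2 * n') * k + 2 * n' * q + n' * k           ≡⟨ regroup n' k q ⟩
  2 * n' * (k + q + k)                              ∎
  where
  open ≤-Reasoning
  regroup : ∀ n' k q → (n' + 2 * n') * k + 2 * n' * q + n' * k ≡ 2 * n' * (k + q + k)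
  regroup = solve-∀

-- If c ≥ n' then (1) says n' = q + 2k, so m = k + t, and the gap is exactly q·t.
large-component : ∀ k q m → q + 2 * k ≤ k + q + m →
                  (q + 2 * k + 2 * (k + q + m)) * k + 2 * (q + 2 * k) * q + (q + 2 * k) * m
                    ≤ 2 * (q + 2 * k) * (k + q + m)
large-component k q m n'≤c
  with m≤n⇒∃[o]m+o≡n (+-cancelˡ-≤ (k + q) k m (subst (_≤ k + q + m) (sym (k+q+k≡q+2k k q)) n'≤c))
... | t , refl = ≤-trans (m≤m+n _ (q * t)) (≤-reflexive (gap k q t))
  where
  gap : ∀ k q t → (q + 2 * k + 2 * (k + q + (k + t))) * k + 2 * (q + 2 * k) * q + (q + 2 * k) * (k + t) + q * t
                  ≡ 2 * (q + 2 * k) * (k + q + (k + t))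
  gap = solve-∀

component-arithmetic : ∀ n' c k q m → c ≡ k + q + m → q + 2 * k ≡ c ⊓ n' →
                       (n' + 2 * c) * k + 2 * n' * q + n' * m ≤ 2 * n' * c
component-arithmetic n' c k q m refl cond with ≤-total c n'
... | inj₁ c≤n' = small-component n' k q m c≤n' (trans cond (m≤n⇒m⊓n≡m c≤n'))
... | inj₂ n'≤c with trans cond (m≥n⇒m⊓n≡n n'≤c)
...   | refl = large-component k q m n'≤c

double-below-half : ∀ {d} n → d < ⌊ n /2⌋ → 2 * d ≤ n ∸ 1
double-below-half {d} n d<half = <⇒≤pred (begin-strict
  2 * d              <⟨ *-monoʳ-< 2 d<half ⟩
  2 * ⌊ n /2⌋        ≡⟨ cong (⌊ n /2⌋ +_) (+-identityʳ ⌊ n /2⌋) ⟩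
  ⌊ n /2⌋ + ⌊ n /2⌋  ≤⟨ +-monoʳ-≤ ⌊ n /2⌋ (⌊n/2⌋≤⌈n/2⌉ n) ⟩
  ⌊ n /2⌋ + ⌈ n /2⌉  ≡⟨ ⌊n/2⌋+⌈n/2⌉≡n n ⟩
  n                  ∎)
  where open ≤-Reasoning

-- The weight w(v) = 4 f(v) + 2 deg(v), a natural number; the combinatorial content of
-- the theorem is that the total weight is at most 2(n-1)·v(G).
module Weight (n : ℕ) {N : ℕ} (G : Graph N) (L : Fin N → Part) (valid : ValidPartition n G L) where
  open ValidPartition valid
  open Connectivity G

  n' : ℕ
  n' = n ∸ 1

  weightOf : Part → ℕ → ℕ
  weightOf S d = n' + 2 * d
  weightOf Q d = 2 * n'
  weightOf I d = 2 * d

  weight : Fin N → ℕ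
  weight u = weightOf (L u) (deg G u)

  cap : ℕ → Part → ℕ
  cap c S = n' + 2 * c
  cap c Q = 2 * n'
  cap c I = n'

  -- the neighbours of u lie in its component, so deg u ≤ |C|; I-vertices have small degree (4)
  weight≤cap : ∀ {v u} → reach G v u ≡ true → weight u ≤ cap (compSize n G L v) (L u)
  weight≤cap {v} {u} r with L u in lu
  ... | S = +-monoʳ-≤ n' (*-monoʳ-≤ 2 (count-mono {A = adj G u} {B = reach G v} (λ x a → reach-trans r (reach-adj a))))
  ... | Q = ≤-refl
  ... | I = double-below-half n (cond4 u lu)

  component-bound : ∀ v → sumOver (reach G v) weight ≤ sumOver (reach G v) (λ _ → 2 * n')
  component-bound v = begin
    sumOver C weight                              ≤⟨ sum-mono capped ⟩
    sumOver C (λ u → cap c (L u))                 ≡⟨ sumOver-by-part (cap c) ⟩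
    (n' + 2 * c) * #S + 2 * n' * #Q + n' * #I     ≤⟨ component-arithmetic n' c #S #Q #I count-by-part (cond1 v) ⟩
    2 * n' * c                                    ≡⟨ sumOver-const C (2 * n') ⟨
    sumOver C (λ _ → 2 * n')                      ∎
    where
    open ≤-Reasoning
    C : Fin N → Bool
    C = reach G v
    c : ℕ
    c = compSize n G L v
    open PartSums L C
    capped : ∀ u → (if C u then weight u else 0) ≤ (if C u then cap c (L u) else 0)
    capped u with C u in r
    ... | true  = weight≤cap r
    ... | false = z≤n

  total-weight : sumℕ weight ≤ N * (2 * n')
  total-weight = begin
    sumℕ weight             ≡⟨ sumℕ≡sum weight ⟩
    sum weight              ≤⟨ ClassSums.sum-by-classes (reach G) reach-refl reach-sym reach-trans
                              weight (λ _ → 2 * n') component-bound ⟩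
    sum {N} (λ _ → 2 * n')  ≡⟨ sum-const N (2 * n') ⟩
    N * (2 * n')            ∎
    where open ≤-Reasoning

-- The embedding k ↦ k/1 of ℕ into ℚ used by the statement is an ordered semiring
-- homomorphism; we check this on unnormalised representatives, where it is integer algebra.
ι : ℕ → ℚ
ι k = ℤ.+ k / 1

ι-unnormalised : ∀ k → toℚᵘ (ι k) ℚᵘ.≃ mkℚᵘ (ℤ.+ k) 0
ι-unnormalised k = ℚ.toℚᵘ-fromℚᵘ (mkℚᵘ (ℤ.+ k) 0)

ι-+ : ∀ a b → ι (a + b) ≡ ι a ℚ.+ ι b
ι-+ a b = ℚ.toℚᵘ-injective (ℚᵘ.≃-trans (ι-unnormalised (a + b)) (ℚᵘ.≃-trans unnormalised
  (ℚᵘ.≃-sym (ℚᵘ.≃-trans (ℚ.toℚᵘ-homo-+ (ι a) (ι b)) (ℚᵘ.+-cong (ι-unnormalised a) (ι-unnormalised b))))))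
  where
  unnormalised : mkℚᵘ (ℤ.+ (a + b)) 0 ℚᵘ.≃ mkℚᵘ (ℤ.+ a) 0 ℚᵘ.+ mkℚᵘ (ℤ.+ b) 0
  unnormalised = *≡* (cong (ℤ._* ℤ.+ 1) (trans (ℤ.pos-+ a b)
    (sym (cong₂ ℤ._+_ (ℤ.*-identityʳ (ℤ.+ a)) (ℤ.*-identityʳ (ℤ.+ b))))))

ι-* : ∀ a b → ι (a * b) ≡ ι a ℚ.* ι b
ι-* a b = ℚ.toℚᵘ-injective (ℚᵘ.≃-trans (ι-unnormalised (a * b)) (ℚᵘ.≃-trans unnormalised
  (ℚᵘ.≃-sym (ℚᵘ.≃-trans (ℚ.toℚᵘ-homo-* (ι a) (ι b)) (ℚᵘ.*-cong (ι-unnormalised a) (ι-unnormalised b))))))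
  where
  unnormalised : mkℚᵘ (ℤ.+ (a * b)) 0 ℚᵘ.≃ mkℚᵘ (ℤ.+ a) 0 ℚᵘ.* mkℚᵘ (ℤ.+ b) 0
  unnormalised = *≡* (cong (ℤ._* ℤ.+ 1) (ℤ.pos-* a b))

ι-mono : ∀ {a b} → a ≤ b → ι a ℚ.≤ ι b
ι-mono {a} {b} a≤b = ℚ.toℚᵘ-cancel-≤
  (ℚᵘ.≤-respʳ-≃ (ℚᵘ.≃-sym (ι-unnormalised b)) (ℚᵘ.≤-respˡ-≃ (ℚᵘ.≃-sym (ι-unnormalised a))
    (*≤* (subst₂ ℤ._≤_ (sym (ℤ.*-identityʳ (ℤ.+ a))) (sym (ℤ.*-identityʳ (ℤ.+ b))) (ℤ.+≤+ a≤b)))))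

fraction : ∀ k d → ℤ.+ k / suc d ≡ ι k ℚ.* (ℤ.+ 1 / suc d)
fraction k d = ℚ.toℚᵘ-injective (ℚᵘ.≃-trans (ℚ.toℚᵘ-fromℚᵘ (mkℚᵘ (ℤ.+ k) d)) (ℚᵘ.≃-trans unnormalised
  (ℚᵘ.≃-sym (ℚᵘ.≃-trans (ℚ.toℚᵘ-homo-* (ι k) (ℤ.+ 1 / suc d))
                          (ℚᵘ.*-cong (ι-unnormalised k) (ℚ.toℚᵘ-fromℚᵘ (mkℚᵘ (ℤ.+ 1) d)))))))
  where
  unnormalised : mkℚᵘ (ℤ.+ k) d ℚᵘ.≃ mkℚᵘ (ℤ.+ k) 0 ℚᵘ.* mkℚᵘ (ℤ.+ 1) d
  unnormalised = *≡* (cong₂ ℤ._*_ (sym (ℤ.*-identityʳ (ℤ.+ k))) (cong (λ t → ℤ.+ suc t) (+-identityʳ d)))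

sumℚ-cong : ∀ {N} {f g : Fin N → ℚ} → (∀ x → f x ≡ g x) → sumℚ f ≡ sumℚ g
sumℚ-cong {zero}  f≗g = refl
sumℚ-cong {suc N} f≗g = cong₂ ℚ._+_ (f≗g zero) (sumℚ-cong (λ x → f≗g (suc x)))

sumℚ-linear : ∀ {N} (p r : ℚ) (f g : Fin N → ℕ) →
              sumℚ (λ x → p ℚ.* ι (f x) ℚ.- r ℚ.* ι (g x)) ≡ p ℚ.* ι (sumℕ f) ℚ.- r ℚ.* ι (sumℕ g)
sumℚ-linear {zero}  p r f g = solve 2 (λ p r → con 0ℚ := p :* con 0ℚ :- r :* con 0ℚ) refl p r
  where open +-*-Solver
sumℚ-linear {suc N} p r f g = begin
  (p ℚ.* ι (f zero) ℚ.- r ℚ.* ι (g zero)) ℚ.+ sumℚ (λ x → p ℚ.* ι (f (suc x)) ℚ.- r ℚ.* ι (g (suc x)))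
    ≡⟨ cong ((p ℚ.* ι (f zero) ℚ.- r ℚ.* ι (g zero)) ℚ.+_) (sumℚ-linear p r (λ x → f (suc x)) (λ x → g (suc x))) ⟩
  (p ℚ.* ι (f zero) ℚ.- r ℚ.* ι (g zero)) ℚ.+ (p ℚ.* ι F′ ℚ.- r ℚ.* ι G′)
    ≡⟨ solve 6 (λ p r a b c d → (p :* a :- r :* b) :+ (p :* c :- r :* d) := p :* (a :+ c) :- r :* (b :+ d))
             refl p r (ι (f zero)) (ι (g zero)) (ι F′) (ι G′) ⟩
  p ℚ.* (ι (f zero) ℚ.+ ι F′) ℚ.- r ℚ.* (ι (g zero) ℚ.+ ι G′)
    ≡⟨ cong₂ (λ s t → p ℚ.* s ℚ.- r ℚ.* t) (ι-+ (f zero) F′) (ι-+ (g zero) G′) ⟨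
  p ℚ.* ι (f zero + F′) ℚ.- r ℚ.* ι (g zero + G′) ∎
  where
  open ≡-Reasoning
  open +-*-Solver
  F′ G′ : ℕ
  F′ = sumℕ (λ x → f (suc x))
  G′ = sumℕ (λ x → g (suc x))

module RationalForm (n : ℕ) {N : ℕ} (G : Graph N) (L : Fin N → Part) (valid : ValidPartition n G L) where
  open Weight n G L valid
  open +-*-Solver

  ¼ : ℚ
  ¼ = ℤ.+ 1 / 4

  f-via-weight : ∀ v → fv n G L v ≡ ¼ ℚ.* ι (weight v) ℚ.- ½ ℚ.* ι (deg G v)
  f-via-weight v with L v
  ... | S = begin
    ℤ.+ n' / 4                                        ≡⟨ fraction n' 3 ⟩
    ι n' ℚ.* ¼                                        ≡⟨ solve 2 (λ x d → x :* con ¼ := con ¼ :* (x :+ con (ι 2) :* d) :- con ½ :* d)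
                                                                refl (ι n') (ι d) ⟩
    ¼ ℚ.* (ι n' ℚ.+ ι 2 ℚ.* ι d) ℚ.- ½ ℚ.* ι d        ≡⟨ cong (λ t → ¼ ℚ.* t ℚ.- ½ ℚ.* ι d)
                                                           (trans (ι-+ n' (2 * d)) (cong (ι n' ℚ.+_) (ι-* 2 d))) ⟨
    ¼ ℚ.* ι (n' + 2 * d) ℚ.- ½ ℚ.* ι d                ∎
    where
    open ≡-Reasoning
    d : ℕ
    d = deg G v
  ... | Q = begin
    ℤ.+ n' / 2 ℚ.- ℤ.+ d / 2                          ≡⟨ cong₂ ℚ._-_ (fraction n' 1) (fraction d 1) ⟩
    ι n' ℚ.* ½ ℚ.- ι d ℚ.* ½                          ≡⟨ solve 2 (λ x d → x :* con ½ :- d :* con ½ := con ¼ :* (con (ι 2) :* x) :- con ½ :* d)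
                                                                refl (ι n') (ι d) ⟩
    ¼ ℚ.* (ι 2 ℚ.* ι n') ℚ.- ½ ℚ.* ι d               ≡⟨ cong (λ t → ¼ ℚ.* t ℚ.- ½ ℚ.* ι d) (ι-* 2 n') ⟨
    ¼ ℚ.* ι (2 * n') ℚ.- ½ ℚ.* ι d                    ∎
    where
    open ≡-Reasoning
    d : ℕ
    d = deg G v
  ... | I = begin
    0ℚ                                                ≡⟨ solve 1 (λ d → con 0ℚ := con ¼ :* (con (ι 2) :* d) :- con ½ :* d) refl (ι d) ⟩
    ¼ ℚ.* (ι 2 ℚ.* ι d) ℚ.- ½ ℚ.* ι d                 ≡⟨ cong (λ t → ¼ ℚ.* t ℚ.- ½ ℚ.* ι d) (ι-* 2 d) ⟨
    ¼ ℚ.* ι (2 * d) ℚ.- ½ ℚ.* ι d                     ∎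
    where
    open ≡-Reasoning
    d : ℕ
    d = deg G v

  fG-via-weight : fG n G ≡ ¼ ℚ.* ι (N * (2 * n')) ℚ.- ½ ℚ.* ι (2 * edges G)
  fG-via-weight = begin
    ℤ.+ n' / 2 ℚ.* ι N ℚ.- ι e                          ≡⟨ cong (λ t → t ℚ.* ι N ℚ.- ι e) (fraction n' 1) ⟩
    ι n' ℚ.* ½ ℚ.* ι N ℚ.- ι e                          ≡⟨ solve 3 (λ x m e → x :* con ½ :* m :- e
                                                                        := con ¼ :* (m :* (con (ι 2) :* x)) :- con ½ :* (con (ι 2) :* e))
                                                                  refl (ι n') (ι N) (ι e) ⟩
    ¼ ℚ.* (ι N ℚ.* (ι 2 ℚ.* ι n')) ℚ.- ½ ℚ.* (ι 2 ℚ.* ι e) ≡⟨ cong₂ (λ s t → ¼ ℚ.* s ℚ.- ½ ℚ.* t)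
                                                               (trans (ι-* N (2 * n')) (cong (ι N ℚ.*_) (ι-* 2 n'))) (ι-* 2 e) ⟨
    ¼ ℚ.* ι (N * (2 * n')) ℚ.- ½ ℚ.* ι (2 * e)          ∎
    where
    open ≡-Reasoning
    e : ℕ
    e = edges G

-- Only conditions (1) and (4) of the partition enter; the evenness of n
-- and the absence of a connected matching matter only for the existence of such partitions.
lemma10 : (n : ℕ) → 0 < n → 2 ∣ n →
          {N : ℕ} (G : Graph N) → ¬ ConnectedMatching G ⌊ n /2⌋ →
          (L : Fin N → Part) → ValidPartition n G L →
          sumℚ (fv n G L) ℚ.≤ fG n G
lemma10 n _ _ {N} G _ L valid = begin
  sumℚ (fv n G L)                                          ≡⟨ sumℚ-cong f-via-weight ⟩
  sumℚ (λ v → ¼ ℚ.* ι (weight v) ℚ.- ½ ℚ.* ι (deg G v))   ≡⟨ sumℚ-linear ¼ ½ weight (deg G) ⟩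
  ¼ ℚ.* ι (sumℕ weight) ℚ.- ½ ℚ.* ι (sumℕ (deg G))        ≡⟨ cong (λ t → ¼ ℚ.* ι (sumℕ weight) ℚ.- ½ ℚ.* ι t)
                                                                (Handshake.handshake G) ⟩
  ¼ ℚ.* ι (sumℕ weight) ℚ.- ½ ℚ.* ι (2 * edges G)         ≤⟨ ℚ.+-monoˡ-≤ (ℚ.- (½ ℚ.* ι (2 * edges G)))
                                                                (ℚ.*-monoˡ-≤-nonNeg ¼ (ι-mono total-weight)) ⟩
  ¼ ℚ.* ι (N * (2 * n')) ℚ.- ½ ℚ.* ι (2 * edges G)        ≡⟨ fG-via-weight ⟨
  fG n G                                                   ∎
  where
  open ℚ.≤-Reasoning
  open Weight n G L valid
  open RationalForm n G L valid
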